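{- Let $H$ be a finite set, and work in $\mathbb{Q}[\beta, h_b^{U}: b\in H]$ with $h_b^{L}:=h_b^U-\beta$. A Stanley diagram is a map $D:H\to\{U,L\}$, identified with the monomial $\prod_{b\in H}h_b^{D_b}$; for a diagram $B$ and $L\subseteq H$ let $B^L$ be the diagram agreeing with $B$ off $L$ and opposite to $B$ on $L$, and write $\bar B_b$ for the opposite of $B_b$. Fix a diagram $B$, a nonempty $Y\subseteq H$, rationals $a_b$ ($b\in Y$) and $d$, and set $$f:=\sum_{b\in Y}a_b\,h_b^{B_b}+d\,\beta .$$ Let $\sigma_b\in\{\pm1\}$ be defined by $h_b^{\bar B_b}=h_b^{B_b}+\sigma_b\beta$ (so $\sigma_b=-1$ if $B_b=U$ and $\sigma_b=+1$ if $B_b=L$), and define $$k:=\sum_{L\subseteq Y}c_L\,B^L,\qquad c_L:=(-1)^{|L|}\Bigl(d-\sum_{b\in Y\setminus L}\sigma_b a_b\Bigr).$$ Then, as polynomials, $$k=(-1)^{|Y|}\Bigl(\prod_{b\in Y}\sigma_b\Bigr)\Bigl(\prod_{b\in H\setminus Y}h_b^{B_b}\Bigr)\beta^{|Y|-1}\,f .$$ In particular, any ring homomorphism (evaluation) that sends $f$ to $0$ sends $k$ to $0$.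
   Context: Here $h_b^U,h_b^L$ are formal "upper/lower hook symbols" of a box $b$, satisfying $h_b^U-h_b^L=\beta$ (the $\alpha$-hook lengths differ by $\alpha-1$, and $\beta$ evaluates to $\alpha-1$). The sum $k$ is called the kernel function of $f$ relative to $B$. -}

module Defs where

open import Level using (Level)
open import Data.Nat using (ℕ; zero; suc; _∸_)
open import Data.Fin using (Fin; zero; suc)
open import Data.Vec using (Vec; []; _∷_; lookup)
open import Data.List using (List; []; _∷_; _++_; map; foldr)
open import Data.Fin.Subset using (Subset; Side; inside; outside; ∣_∣)
open import Data.Rational as ℚ using (ℚ; 0ℚ; 1ℚ)
open import Algebra.Bundles using (CommutativeRing)

data UL : Set where
  U L : UL

opp : UL → UL
opp U = L
opp L = U

Diagram : ℕ → Set
Diagram n = Fin n → UL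

flipOn : ∀ {n} → Diagram n → Subset n → Diagram n
flipOn B Lset b with lookup Lset b
... | inside  = opp (B b)
... | outside = B b

subsetsOf : ∀ {n} → Subset n → List (Subset n)
subsetsOf [] = [] ∷ []
subsetsOf (outside ∷ p) = map (outside ∷_) (subsetsOf p)
subsetsOf (inside ∷ p) =
  map (outside ∷_) (subsetsOf p) ++ map (inside ∷_) (subsetsOf p)

diff : ∀ {n} → Subset n → Subset n → Subset n
diff [] [] = []
diff (y ∷ ys) (inside ∷ ls) = outside ∷ diff ys ls
diff (y ∷ ys) (outside ∷ ls) = y ∷ diff ys ls

σ : UL → ℚ
σ U = ℚ.- 1ℚ
σ L = 1ℚ

sumℚOver : ∀ {n} → Subset n → (Fin n → ℚ) → ℚ
sumℚOver {zero} [] g = 0ℚ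
sumℚOver {suc n} (inside ∷ S) g = g zero ℚ.+ sumℚOver S (λ i → g (suc i))
sumℚOver {suc n} (outside ∷ S) g = sumℚOver S (λ i → g (suc i))

prodℚOver : ∀ {n} → Subset n → (Fin n → ℚ) → ℚ
prodℚOver {zero} [] g = 1ℚ
prodℚOver {suc n} (inside ∷ S) g = g zero ℚ.* prodℚOver S (λ i → g (suc i))
prodℚOver {suc n} (outside ∷ S) g = prodℚOver S (λ i → g (suc i))

powℚ : ℚ → ℕ → ℚ
powℚ x zero = 1ℚ
powℚ x (suc m) = x ℚ.* powℚ x m

coeff : ∀ {n} → Diagram n → Subset n → (Fin n → ℚ) → ℚ → Subset n → ℚ
coeff B Y a d Lset =
  powℚ (ℚ.- 1ℚ) ∣ Lset ∣ ℚ.* (d ℚ.- sumℚOver (diff Y Lset) (λ b → σ (B b) ℚ.* a b))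

-- Evaluation in an arbitrary commutative ring R with a map φ : ℚ → R
-- (a ring homomorphism in the statement), at β and h^U_b.
module Eval {c ℓ : Level} (R : CommutativeRing c ℓ) (φ : ℚ → CommutativeRing.Carrier R) where
  open CommutativeRing R using (Carrier; _+_; _*_; _-_; 0#; 1#)

  sumOver : ∀ {n} → Subset n → (Fin n → Carrier) → Carrier
  sumOver {zero} [] g = 0#
  sumOver {suc n} (inside ∷ S) g = g zero + sumOver S (λ i → g (suc i))
  sumOver {suc n} (outside ∷ S) g = sumOver S (λ i → g (suc i))

  prodOver : ∀ {n} → Subset n → (Fin n → Carrier) → Carrier
  prodOver {zero} [] g = 1#
  prodOver {suc n} (inside ∷ S) g = g zero * prodOver S (λ i → g (suc i))
  prodOver {suc n} (outside ∷ S) g = prodOver S (λ i → g (suc i))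

  pow : Carrier → ℕ → Carrier
  pow x zero = 1#
  pow x (suc m) = x * pow x m

  sumList : List Carrier → Carrier
  sumList = foldr _+_ 0#

  module _ {n : ℕ} (β : Carrier) (hU : Fin n → Carrier) where
    hook : Fin n → UL → Carrier
    hook b U = hU b
    hook b L = hU b - β

    mono : Diagram n → Carrier
    mono D = prodOver (Data.Fin.Subset.⊤) (λ b → hook b (D b))

    fPoly : Diagram n → Subset n → (Fin n → ℚ) → ℚ → Carrier
    fPoly B Y a d = sumOver Y (λ b → φ (a b) * hook b (B b)) + φ d * β

    kernel : Diagram n → Subset n → (Fin n → ℚ) → ℚ → Carrier
    kernel B Y a d =
      sumList (map (λ Lset → φ (coeff B Y a d Lset) * mono (flipOn B Lset)) (subsetsOf Y))

    rhs : Diagram n → Subset n → (Fin n → ℚ) → ℚ → Carrier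
    rhs B Y a d =
      φ (powℚ (ℚ.- 1ℚ) ∣ Y ∣ ℚ.* prodℚOver Y (λ b → σ (B b)))
      * prodOver (Data.Fin.Subset.∁ Y) (λ b → hook b (B b))
      * pow β (∣ Y ∣ ∸ 1)
      * fPoly B Y a d

module Submission where

-- Induction on the boxes, peeling off the first box b₀ with x₀ = h_{b₀}^{B_{b₀}} and
-- y₀ = h_{b₀}^{B̄_{b₀}} = x₀ + σ₀ β. If b₀ ∉ Y then k = x₀ k′(d), where k′(e) is the kernel of the
-- remaining data with constant e. If b₀ ∈ Y, sorting the L ⊆ Y by whether b₀ ∈ L gives
-- k = x₀ k′(d - σ₀ a₀) - y₀ k′(d) = x₀ (k′(d - σ₀ a₀) - k′(d)) - σ₀ β k′(d), and as the
-- factorised form is affine in d, the difference is -σ₀ a₀ times its d-coefficient.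
-- So that the induction also covers Y = ∅, where k = d ∏_b h_b^{B_b}, the claim is proved as
-- k = (-1)^{|Y|} (∏_Y σ) (∏_{H∖Y} h^B) (β^{|Y|} d + β^{|Y|-1} Σ_Y a_b h_b^{B_b}),
-- which is the theorem once Y ≠ ∅.

open import Defs
open import Level using (Level)
open import Data.Nat using (ℕ; zero; suc; _∸_; NonZero; nonZero)
open import Data.Fin using (Fin; zero; suc)
open import Data.Fin.Subset using (Subset; Nonempty; inside; outside; ∣_∣; ∁; ⊤)
open import Data.Vec using ([]; _∷_; lookup; here; there)
open import Data.List using ([]; _∷_; _++_; map)
open import Data.List.Properties using (map-++; map-∘)
open import Data.Rational as ℚ using (ℚ; 0ℚ; 1ℚ)
open import Data.Rational.Properties using (+-*-rawRing; _≟_)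
open import Data.Rational.Solver using (module +-*-Solver)
open import Data.Product using (_×_; _,_)
open import Function using (_∘_)
open import Algebra.Bundles using (CommutativeRing)
open import Algebra.Morphism.Structures using (IsRingHomomorphism)
open import Data.Maybe using (Maybe; just; nothing)
open import Relation.Nullary using (yes; no)
open import Algebra.Solver.Ring.AlmostCommutativeRing using (fromCommutativeRing; _-Raw-AlmostCommutative⟶_)
import Relation.Binary.PropositionalEquality as ≡
open ≡ using (_≡_)

kernelSign : ∀ {n} → Diagram n → Subset n → ℚ
kernelSign B Y = powℚ (ℚ.- 1ℚ) ∣ Y ∣ ℚ.* prodℚOver Y (λ b → σ (B b))

module _ {n : ℕ} (B : Diagram (suc n)) (a : Fin (suc n) → ℚ) (d : ℚ) where
  open +-*-Solver

  coeff-flippedHead : ∀ s Y S → coeff B (s ∷ Y) a d (inside ∷ S) ≡ ℚ.- coeff (B ∘ suc) Y (a ∘ suc) d S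
  coeff-flippedHead s Y S =
    solve 2 (λ p q → (:- con 1ℚ :* p) :* q := :- (p :* q)) ≡.refl
      (powℚ (ℚ.- 1ℚ) ∣ S ∣) (d ℚ.- sumℚOver (diff Y S) (λ b → σ (B (suc b)) ℚ.* a (suc b)))

  coeff-unflippedHead : ∀ Y S →
    coeff B (inside ∷ Y) a d (outside ∷ S) ≡ coeff (B ∘ suc) Y (a ∘ suc) (d ℚ.- σ (B zero) ℚ.* a zero) S
  coeff-unflippedHead Y S =
    solve 4 (λ p e s t → p :* (e :- (s :+ t)) := p :* (e :- s :- t)) ≡.refl
      (powℚ (ℚ.- 1ℚ) ∣ S ∣) d (σ (B zero) ℚ.* a zero) (sumℚOver (diff Y S) (λ b → σ (B (suc b)) ℚ.* a (suc b)))

kernelSign-inside∷ : ∀ {n} (B : Diagram (suc n)) Y → kernelSign B (inside ∷ Y) ≡ ℚ.- σ (B zero) ℚ.* kernelSign (B ∘ suc) Y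
kernelSign-inside∷ B Y =
  solve 3 (λ p s q → (:- con 1ℚ :* p) :* (s :* q) := :- s :* (p :* q)) ≡.refl
    (powℚ (ℚ.- 1ℚ) ∣ Y ∣) (σ (B zero)) (prodℚOver Y (λ b → σ (B (suc b))))
  where open +-*-Solver

coeff-[] : (B : Diagram 0) (a : Fin 0 → ℚ) (d : ℚ) → coeff B [] a d [] ≡ d
coeff-[] B a d = solve 1 (λ e → con 1ℚ :* (e :- con 0ℚ) := e) ≡.refl d
  where open +-*-Solver

nonempty⇒nonZero : ∀ {n} {p : Subset n} → Nonempty p → NonZero ∣ p ∣
nonempty⇒nonZero                 (zero  , here)        = nonZero
nonempty⇒nonZero {p = inside ∷ _}  (suc _ , there _)   = nonZero
nonempty⇒nonZero {p = outside ∷ _} (suc x , there x∈p) = nonempty⇒nonZero (x , x∈p)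

module Kernel {c ℓ : Level} (R : CommutativeRing c ℓ) (φ : ℚ → CommutativeRing.Carrier R)
  (φ-isRingHomomorphism : IsRingHomomorphism +-*-rawRing (CommutativeRing.rawRing R) φ) where

  open CommutativeRing R hiding (zero)
  open IsRingHomomorphism φ-isRingHomomorphism using (+-homo; *-homo; -‿homo; 0#-homo; 1#-homo)
  open Eval R φ
  open import Relation.Binary.Reasoning.Setoid setoid
  open import Algebra.Properties.CommutativeSemigroup *-commutativeSemigroup using (x∙yz≈y∙xz)

  -- The ring solver runs with rational coefficients, interpreted through φ, so that constants
  -- such as -1 + 1 are recognised as zero.
  φ-morphism : +-*-rawRing -Raw-AlmostCommutative⟶ fromCommutativeRing R
  φ-morphism = record
    { ⟦_⟧ = φ ; +-homo = +-homo ; *-homo = *-homo ; -‿homo = -‿homo ; 0-homo = 0#-homo ; 1-homo = 1#-homo }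

  φ-equal? : ∀ p q → Maybe (φ p ≈ φ q)
  φ-equal? p q with p ≟ q
  ... | yes ≡.refl = just refl
  ... | no _       = nothing

  open import Algebra.Solver.Ring +-*-rawRing (fromCommutativeRing R) φ-morphism φ-equal?
    using (solve; _:+_; _:-_; _:*_; :-_; con; _:=_)

  sumList-++ : ∀ xs ys → sumList (xs ++ ys) ≈ sumList xs + sumList ys
  sumList-++ []       ys = sym (+-identityˡ _)
  sumList-++ (x ∷ xs) ys = trans (+-congˡ (sumList-++ xs ys)) (sym (+-assoc _ _ _))

  module _ {A : Set} where
    sumList-map-cong : ∀ {F G : A → Carrier} xs → (∀ x → F x ≈ G x) → sumList (map F xs) ≈ sumList (map G xs)
    sumList-map-cong []       F≈G = refl
    sumList-map-cong (x ∷ xs) F≈G = +-cong (F≈G x) (sumList-map-cong xs F≈G)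

    sumList-map-*ˡ : ∀ k (F : A → Carrier) xs → sumList (map (λ x → k * F x) xs) ≈ k * sumList (map F xs)
    sumList-map-*ˡ k F []       = sym (zeroʳ k)
    sumList-map-*ˡ k F (x ∷ xs) = trans (+-congˡ (sumList-map-*ˡ k F xs)) (sym (distribˡ k _ _))

  sumSubsets : ∀ {n} → (Subset n → Carrier) → Subset n → Carrier
  sumSubsets F Y = sumList (map F (subsetsOf Y))

  sumSubsets-outside∷ : ∀ {n} (F : Subset (suc n) → Carrier) Y →
    sumSubsets F (outside ∷ Y) ≈ sumSubsets (F ∘ (outside ∷_)) Y
  sumSubsets-outside∷ F Y = reflexive (≡.cong sumList (≡.sym (map-∘ (subsetsOf Y))))

  sumSubsets-inside∷ : ∀ {n} (F : Subset (suc n) → Carrier) Y →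
    sumSubsets F (inside ∷ Y) ≈ sumSubsets (F ∘ (outside ∷_)) Y + sumSubsets (F ∘ (inside ∷_)) Y
  sumSubsets-inside∷ F Y = begin
    sumList (map F (map (outside ∷_) Ys ++ map (inside ∷_) Ys))
      ≡⟨ ≡.cong sumList (map-++ F (map (outside ∷_) Ys) (map (inside ∷_) Ys)) ⟩
    sumList (map F (map (outside ∷_) Ys) ++ map F (map (inside ∷_) Ys))
      ≈⟨ sumList-++ (map F (map (outside ∷_) Ys)) _ ⟩
    sumList (map F (map (outside ∷_) Ys)) + sumList (map F (map (inside ∷_) Ys))
      ≡⟨ ≡.cong₂ (λ u v → sumList u + sumList v) (≡.sym (map-∘ Ys)) (≡.sym (map-∘ Ys)) ⟩
    sumSubsets (F ∘ (outside ∷_)) Y + sumSubsets (F ∘ (inside ∷_)) Y ∎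
    where Ys = subsetsOf Y

  sumOver-cong : ∀ {n} (S : Subset n) {g h : Fin n → Carrier} → (∀ i → g i ≈ h i) → sumOver S g ≈ sumOver S h
  sumOver-cong []            g≈h = refl
  sumOver-cong (inside ∷ S)  g≈h = +-cong (g≈h zero) (sumOver-cong S (g≈h ∘ suc))
  sumOver-cong (outside ∷ S) g≈h = sumOver-cong S (g≈h ∘ suc)

  prodOver-cong : ∀ {n} (S : Subset n) {g h : Fin n → Carrier} → (∀ i → g i ≈ h i) → prodOver S g ≈ prodOver S h
  prodOver-cong []            g≈h = refl
  prodOver-cong (inside ∷ S)  g≈h = *-cong (g≈h zero) (prodOver-cong S (g≈h ∘ suc))
  prodOver-cong (outside ∷ S) g≈h = prodOver-cong S (g≈h ∘ suc)

  sumOver-∣∣≡0 : ∀ {n} (Y : Subset n) g → ∣ Y ∣ ≡ 0 → sumOver Y g ≈ 0#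
  sumOver-∣∣≡0 []            g ∣Y∣≡0 = refl
  sumOver-∣∣≡0 (outside ∷ Y) g ∣Y∣≡0 = sumOver-∣∣≡0 Y (g ∘ suc) ∣Y∣≡0

  -- The truncated ∣ Y ∣ ∸ 1 is harmless because it is wrong only when Y, hence the sum, is empty.
  pow-pred-sumOver : ∀ {n} x (Y : Subset n) g → x * (pow x (∣ Y ∣ ∸ 1) * sumOver Y g) ≈ pow x ∣ Y ∣ * sumOver Y g
  pow-pred-sumOver x Y g with ∣ Y ∣ in ∣Y∣≡m
  ... | suc _ = sym (*-assoc x _ _)
  ... | zero  = trans (*-congˡ 1*sum≈0) (trans (zeroʳ x) (sym 1*sum≈0))
    where
    1*sum≈0 : 1# * sumOver Y g ≈ 0#
    1*sum≈0 = trans (*-congˡ (sumOver-∣∣≡0 Y g ∣Y∣≡m)) (zeroʳ 1#)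

  hookProd : ∀ {n} → Carrier → (Fin n → Carrier) → Diagram n → Subset n → Carrier
  hookProd β hU B S = prodOver S (λ b → hook β hU b (B b))

  hookSum : ∀ {n} → Carrier → (Fin n → Carrier) → Diagram n → (Fin n → ℚ) → Subset n → Carrier
  hookSum β hU B a S = sumOver S (λ b → φ (a b) * hook β hU b (B b))

  module _ {n : ℕ} (β : Carrier) (hU : Fin (suc n) → Carrier) where
    hook-suc : ∀ i X → hook β hU (suc i) X ≡ hook β (hU ∘ suc) i X
    hook-suc i U = ≡.refl
    hook-suc i L = ≡.refl

    mono-suc : (D : Diagram (suc n)) → mono β hU D ≈ hook β hU zero (D zero) * mono β (hU ∘ suc) (D ∘ suc)
    mono-suc D = *-congˡ (prodOver-cong ⊤ (λ i → reflexive (hook-suc i (D (suc i)))))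

    hookProd-suc : ∀ (B : Diagram (suc n)) S →
      prodOver S (λ i → hook β hU (suc i) (B (suc i))) ≈ hookProd β (hU ∘ suc) (B ∘ suc) S
    hookProd-suc B S = prodOver-cong S (λ i → reflexive (hook-suc i (B (suc i))))

    hookSum-suc : ∀ (B : Diagram (suc n)) (a : Fin (suc n) → ℚ) S →
      sumOver S (λ i → φ (a (suc i)) * hook β hU (suc i) (B (suc i))) ≈ hookSum β (hU ∘ suc) (B ∘ suc) (a ∘ suc) S
    hookSum-suc B a S = sumOver-cong S (λ i → *-congˡ (reflexive (hook-suc i (B (suc i)))))

  hook-opp : ∀ {n} β (hU : Fin n → Carrier) b X → hook β hU b (opp X) ≈ hook β hU b X + φ (σ X) * β
  hook-opp β hU b U = solve 2 (λ h x → h :- x := h :+ con (ℚ.- 1ℚ) :* x) refl (hU b) β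
  hook-opp β hU b L = solve 2 (λ h x → h := h :- x :+ con 1ℚ :* x) refl (hU b) β

  mono-cong : ∀ {n} β (hU : Fin n → Carrier) {D D′ : Diagram n} → (∀ b → D b ≡ D′ b) → mono β hU D ≈ mono β hU D′
  mono-cong β hU D≡D′ = prodOver-cong ⊤ (λ b → reflexive (≡.cong (hook β hU b) (D≡D′ b)))

  flipOn-suc : ∀ {n} (B : Diagram (suc n)) s S i → flipOn B (s ∷ S) (suc i) ≡ flipOn (B ∘ suc) S i
  flipOn-suc B s S i with lookup S i
  ... | inside  = ≡.refl
  ... | outside = ≡.refl

  mono-flipOn-∷ : ∀ {n} β (hU : Fin (suc n) → Carrier) (B : Diagram (suc n)) s S →
    mono β hU (flipOn B (s ∷ S)) ≈ hook β hU zero (flipOn B (s ∷ S) zero) * mono β (hU ∘ suc) (flipOn (B ∘ suc) S)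
  mono-flipOn-∷ β hU B s S =
    trans (mono-suc β hU (flipOn B (s ∷ S))) (*-congˡ (mono-cong β (hU ∘ suc) (flipOn-suc B s S)))

  module _ {n : ℕ} (β : Carrier) (hU : Fin (suc n) → Carrier) (B : Diagram (suc n)) (a : Fin (suc n) → ℚ) where
    private
      x₀ y₀ : Carrier
      x₀ = hook β hU zero (B zero)
      y₀ = hook β hU zero (opp (B zero))
      kernel′ : Subset n → ℚ → Carrier
      kernel′ = λ Y → kernel β (hU ∘ suc) (B ∘ suc) Y (a ∘ suc)
      term′ : Subset n → ℚ → Subset n → Carrier
      term′ Y e S = φ (coeff (B ∘ suc) Y (a ∘ suc) e S) * mono β (hU ∘ suc) (flipOn (B ∘ suc) S)

    kernel-outside∷ : ∀ Y d → kernel β hU B (outside ∷ Y) a d ≈ x₀ * kernel′ Y d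
    kernel-outside∷ Y d = begin
      kernel β hU B (outside ∷ Y) a d
        ≈⟨ sumSubsets-outside∷ _ Y ⟩
      sumSubsets (λ S → φ (coeff (B ∘ suc) Y (a ∘ suc) d S) * mono β hU (flipOn B (outside ∷ S))) Y
        ≈⟨ sumList-map-cong (subsetsOf Y) (λ S → trans (*-congˡ (mono-flipOn-∷ β hU B outside S)) (x∙yz≈y∙xz _ _ _)) ⟩
      sumSubsets (λ S → x₀ * term′ Y d S) Y
        ≈⟨ sumList-map-*ˡ x₀ (term′ Y d) (subsetsOf Y) ⟩
      x₀ * kernel′ Y d ∎

    kernel-inside∷ : ∀ Y d →
      kernel β hU B (inside ∷ Y) a d ≈ x₀ * kernel′ Y (d ℚ.- σ (B zero) ℚ.* a zero) + (- y₀) * kernel′ Y d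
    kernel-inside∷ Y d = begin
      kernel β hU B (inside ∷ Y) a d
        ≈⟨ sumSubsets-inside∷ _ Y ⟩
      sumSubsets (λ S → φ (coeff B (inside ∷ Y) a d (outside ∷ S)) * mono β hU (flipOn B (outside ∷ S))) Y
        + sumSubsets (λ S → φ (coeff B (inside ∷ Y) a d (inside ∷ S)) * mono β hU (flipOn B (inside ∷ S))) Y
        ≈⟨ +-cong (sumList-map-cong (subsetsOf Y) unflipped) (sumList-map-cong (subsetsOf Y) flipped) ⟩
      sumSubsets (λ S → x₀ * term′ Y d₀ S) Y + sumSubsets (λ S → (- y₀) * term′ Y d S) Y
        ≈⟨ +-cong (sumList-map-*ˡ x₀ (term′ Y d₀) (subsetsOf Y)) (sumList-map-*ˡ (- y₀) (term′ Y d) (subsetsOf Y)) ⟩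
      x₀ * kernel′ Y d₀ + (- y₀) * kernel′ Y d ∎
      where
      d₀ : ℚ
      d₀ = d ℚ.- σ (B zero) ℚ.* a zero

      unflipped : ∀ S → φ (coeff B (inside ∷ Y) a d (outside ∷ S)) * mono β hU (flipOn B (outside ∷ S)) ≈ x₀ * term′ Y d₀ S
      unflipped S = trans
        (*-cong (reflexive (≡.cong φ (coeff-unflippedHead B a d Y S))) (mono-flipOn-∷ β hU B outside S))
        (x∙yz≈y∙xz _ _ _)

      flipped : ∀ S → φ (coeff B (inside ∷ Y) a d (inside ∷ S)) * mono β hU (flipOn B (inside ∷ S)) ≈ (- y₀) * term′ Y d S
      flipped S = trans
        (*-cong (trans (reflexive (≡.cong φ (coeff-flippedHead B a d inside Y S))) (-‿homo _)) (mono-flipOn-∷ β hU B inside S))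
        (solve 3 (λ p y m → (:- p) :* (y :* m) := (:- y) :* (p :* m)) refl _ y₀ _)

  factorised-step : ∀ {n} β (Y : Subset n) g x q e c p f →
    let βᵐ = pow β ∣ Y ∣; βᵐ⁻¹ = pow β (∣ Y ∣ ∸ 1); Σ = sumOver Y g in
    x * (c * p * (βᵐ * (f - q * e) + βᵐ⁻¹ * Σ)) + (- (x + q * β)) * (c * p * (βᵐ * f + βᵐ⁻¹ * Σ))
      ≈ (- q * c) * p * (β * βᵐ * f + βᵐ * (e * x + Σ))
  factorised-step β Y g x q e c p f = begin
    x * (c * p * (βᵐ * (f - q * e) + βᵐ⁻¹ * Σ)) + (- (x + q * β)) * (c * p * (βᵐ * f + βᵐ⁻¹ * Σ))
      ≈⟨ solve 10 (λ x q e b c p k j t f →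
           x :* (c :* p :* (k :* (f :- q :* e) :+ j :* t)) :+ (:- (x :+ q :* b)) :* (c :* p :* (k :* f :+ j :* t))
           := (:- q :* c) :* p :* (b :* k :* f :+ k :* (e :* x) :+ b :* (j :* t)))
         refl x q e β c p βᵐ βᵐ⁻¹ Σ f ⟩
    (- q * c) * p * (β * βᵐ * f + βᵐ * (e * x) + β * (βᵐ⁻¹ * Σ))
      ≈⟨ *-congˡ (+-congˡ (pow-pred-sumOver β Y g)) ⟩
    (- q * c) * p * (β * βᵐ * f + βᵐ * (e * x) + βᵐ * Σ)
      ≈⟨ *-congˡ (trans (+-assoc _ _ _) (+-congˡ (sym (distribˡ βᵐ _ _)))) ⟩
    (- q * c) * p * (β * βᵐ * f + βᵐ * (e * x + Σ)) ∎
    where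
    βᵐ = pow β ∣ Y ∣
    βᵐ⁻¹ = pow β (∣ Y ∣ ∸ 1)
    Σ = sumOver Y g

  factorisedKernel : ∀ {n} → Carrier → (Fin n → Carrier) → Diagram n → Subset n → (Fin n → ℚ) → ℚ → Carrier
  factorisedKernel β hU B Y a d =
    φ (kernelSign B Y) * hookProd β hU B (∁ Y) * (pow β ∣ Y ∣ * φ d + pow β (∣ Y ∣ ∸ 1) * hookSum β hU B a Y)

  kernel-factorisation : ∀ {n} β (hU : Fin n → Carrier) B Y a d → kernel β hU B Y a d ≈ factorisedKernel β hU B Y a d
  kernel-factorisation β hU B [] a d = begin
    φ (coeff B [] a d []) * 1# + 0#  ≈⟨ trans (+-identityʳ _) (*-identityʳ _) ⟩
    φ (coeff B [] a d [])            ≡⟨ ≡.cong φ (coeff-[] B a d) ⟩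
    φ d                              ≈⟨ solve 1 (λ e → e := con 1ℚ :* con 1ℚ :* (con 1ℚ :* e :+ con 1ℚ :* con 0ℚ)) refl (φ d) ⟩
    φ 1ℚ * φ 1ℚ * (φ 1ℚ * φ d + φ 1ℚ * φ 0ℚ)
      ≈⟨ *-cong (*-congˡ 1#-homo) (+-cong (*-congʳ 1#-homo) (*-cong 1#-homo 0#-homo)) ⟩
    factorisedKernel β hU B [] a d   ∎
  kernel-factorisation β hU B (outside ∷ Y) a d = begin
    kernel β hU B (outside ∷ Y) a d
      ≈⟨ kernel-outside∷ β hU B a Y d ⟩
    x₀ * kernel β hU′ B′ Y a′ d
      ≈⟨ *-congˡ (kernel-factorisation β hU′ B′ Y a′ d) ⟩
    x₀ * (c′ * P′ * W′)
      ≈⟨ solve 4 (λ x c p w → x :* (c :* p :* w) := c :* (x :* p) :* w) refl x₀ c′ P′ W′ ⟩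
    c′ * (x₀ * P′) * W′
      ≈⟨ sym (*-cong (*-congˡ (*-congˡ (hookProd-suc β hU B (∁ Y)))) (+-congˡ (*-congˡ (hookSum-suc β hU B a Y)))) ⟩
    factorisedKernel β hU B (outside ∷ Y) a d ∎
    where
    hU′ = hU ∘ suc
    B′ = B ∘ suc
    a′ = a ∘ suc
    x₀ = hook β hU zero (B zero)
    c′ = φ (kernelSign B′ Y)
    P′ = hookProd β hU′ B′ (∁ Y)
    W′ = pow β ∣ Y ∣ * φ d + pow β (∣ Y ∣ ∸ 1) * hookSum β hU′ B′ a′ Y
  kernel-factorisation β hU B (inside ∷ Y) a d = begin
    kernel β hU B (inside ∷ Y) a d
      ≈⟨ kernel-inside∷ β hU B a Y d ⟩
    x₀ * kernel β hU′ B′ Y a′ d₀ + (- y₀) * kernel β hU′ B′ Y a′ d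
      ≈⟨ +-cong (*-congˡ (kernel-factorisation β hU′ B′ Y a′ d₀))
                (*-cong (-‿cong (hook-opp β hU zero (B zero))) (kernel-factorisation β hU′ B′ Y a′ d)) ⟩
    x₀ * (c′ * P′ * (βᵐ * φ d₀ + βᵐ⁻¹ * Σ′)) + (- (x₀ + q₀ * β)) * (c′ * P′ * (βᵐ * φ d + βᵐ⁻¹ * Σ′))
      ≈⟨ +-congʳ (*-congˡ (*-congˡ (+-congʳ (*-congˡ φd₀≈)))) ⟩
    x₀ * (c′ * P′ * (βᵐ * (φ d - q₀ * e₀) + βᵐ⁻¹ * Σ′)) + (- (x₀ + q₀ * β)) * (c′ * P′ * (βᵐ * φ d + βᵐ⁻¹ * Σ′))
      ≈⟨ factorised-step β Y _ x₀ q₀ e₀ c′ P′ (φ d) ⟩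
    (- q₀ * c′) * P′ * (β * βᵐ * φ d + βᵐ * (e₀ * x₀ + Σ′))
      ≈⟨ sym (*-cong (*-cong φ-kernelSign≈ (hookProd-suc β hU B (∁ Y)))
                     (+-congˡ (*-congˡ (+-congˡ (hookSum-suc β hU B a Y))))) ⟩
    factorisedKernel β hU B (inside ∷ Y) a d ∎
    where
    hU′ = hU ∘ suc
    B′ = B ∘ suc
    a′ = a ∘ suc
    x₀ = hook β hU zero (B zero)
    y₀ = hook β hU zero (opp (B zero))
    q₀ = φ (σ (B zero))
    e₀ = φ (a zero)
    d₀ = d ℚ.- σ (B zero) ℚ.* a zero
    c′ = φ (kernelSign B′ Y)
    P′ = hookProd β hU′ B′ (∁ Y)
    Σ′ = hookSum β hU′ B′ a′ Y
    βᵐ = pow β ∣ Y ∣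
    βᵐ⁻¹ = pow β (∣ Y ∣ ∸ 1)

    φd₀≈ : φ d₀ ≈ φ d - q₀ * e₀
    φd₀≈ = trans (+-homo _ _) (+-congˡ (trans (-‿homo _) (-‿cong (*-homo _ _))))

    φ-kernelSign≈ : φ (kernelSign B (inside ∷ Y)) ≈ - q₀ * c′
    φ-kernelSign≈ = trans (reflexive (≡.cong φ (kernelSign-inside∷ B Y))) (trans (*-homo _ _) (*-congʳ (-‿homo _)))

  pow-regroup : ∀ m .{{_ : NonZero m}} c p x e s →
    c * p * (pow x m * e + pow x (m ∸ 1) * s) ≈ c * p * pow x (m ∸ 1) * (s + e * x)
  pow-regroup (suc k) c p x e s =
    solve 6 (λ c p x e s xᵏ → c :* p :* (x :* xᵏ :* e :+ xᵏ :* s) := c :* p :* xᵏ :* (s :+ e :* x)) refl c p x e s (pow x k)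

  module _ {n : ℕ} (β : Carrier) (hU : Fin n → Carrier) (B : Diagram n) (Y : Subset n) (Y≢∅ : Nonempty Y) (a : Fin n → ℚ) (d : ℚ) where
    kernel≈rhs : kernel β hU B Y a d ≈ rhs β hU B Y a d
    kernel≈rhs = trans (kernel-factorisation β hU B Y a d)
      (pow-regroup ∣ Y ∣ {{nonempty⇒nonZero Y≢∅}} _ _ β (φ d) (hookSum β hU B a Y))

    kernel≈0 : fPoly β hU B Y a d ≈ 0# → kernel β hU B Y a d ≈ 0#
    kernel≈0 f≈0 = trans kernel≈rhs (trans (*-congˡ f≈0) (zeroʳ _))

mainTheorem5 : ∀ {c ℓ : Level} (R : CommutativeRing c ℓ)
    (φ : ℚ → CommutativeRing.Carrier R)
    → IsRingHomomorphism +-*-rawRing (CommutativeRing.rawRing R) φ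
    → ∀ {n : ℕ} (β : CommutativeRing.Carrier R) (hU : Fin n → CommutativeRing.Carrier R)
      (B : Diagram n) (Y : Subset n) → Nonempty Y
    → (a : Fin n → ℚ) (d : ℚ)
    → CommutativeRing._≈_ R (Eval.kernel R φ β hU B Y a d) (Eval.rhs R φ β hU B Y a d)
      × (CommutativeRing._≈_ R (Eval.fPoly R φ β hU B Y a d) (CommutativeRing.0# R)
         → CommutativeRing._≈_ R (Eval.kernel R φ β hU B Y a d) (CommutativeRing.0# R))
mainTheorem5 R φ φ-hom β hU B Y Y≢∅ a d =
  kernel≈rhs β hU B Y Y≢∅ a d , kernel≈0 β hU B Y Y≢∅ a d
  where open Kernel R φ φ-hom using (kernel≈rhs; kernel≈0)
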